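{- Let $m_1,m_2$ be positive integers and let $A$ be an antichain in $[m_1]\times[m_2]$. Then the augmentation matrix of $A$ has the consecutive ones property in rows and in columns: in every row and in every column of this matrix, no entry $0$ lies strictly between two entries equal to $1$.
   Context: $[m]=\{1,\dots,m\}$. On $[m_1]\times[m_2]$, $(x,y)>^*(z,w)$ iff $x\ge z$, $y\ge w$ and at least one inequality is strict. An antichain is a subset of $[m_1]\times[m_2]$ whose distinct elements are pairwise incomparable for $>^*$. The augmentation matrix of an antichain $A$ is the $m_1\times m_2$ $0$–$1$ matrix whose rows are indexed by $1,\dots,m_1$ and columns by $1,\dots,m_2$ in increasing order, whose $(x,y)$ entry is $0$ if $(x,y)\in A$, or $(x,y)>^*a$ for some $a\in A$, or $a>^*(x,y)$ for some $a\in A$; and whose $(x,y)$ entry is $1$ otherwise. -}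

module Defs where

open import Data.Nat using (ℕ; _≤_; _<_)
open import Data.Product using (_×_; _,_; ∃)
open import Data.Sum using (_⊎_)
open import Relation.Nullary using (¬_)
open import Relation.Binary.PropositionalEquality using (_≡_)

Point : Set
Point = ℕ × ℕ

InGrid : ℕ → ℕ → Point → Set
InGrid m₁ m₂ (x , y) = (1 ≤ x × x ≤ m₁) × (1 ≤ y × y ≤ m₂)

_>*_ : Point → Point → Set
(x , y) >* (z , w) = (z ≤ x × w ≤ y) × (z < x ⊎ w < y)

Subset : Set₁
Subset = Point → Set

IsAntichain : ℕ → ℕ → Subset → Set
IsAntichain m₁ m₂ A =
  (∀ p → A p → InGrid m₁ m₂ p) ×
  (∀ p q → A p → A q → ¬ (p ≡ q) → ¬ (p >* q) × ¬ (q >* p))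

-- the (x,y) entry of the augmentation matrix of A is 0
EntryZero : Subset → Point → Set
EntryZero A p = A p ⊎ (∃ λ a → A a × p >* a) ⊎ (∃ λ a → A a × a >* p)

EntryOne : Subset → Point → Set
EntryOne A p = ¬ EntryZero A p

ConsecutiveOnesRows : ℕ → ℕ → Subset → Set
ConsecutiveOnesRows m₁ m₂ A =
  ∀ x y₁ y₂ y₃ → 1 ≤ x → x ≤ m₁ → 1 ≤ y₁ → y₁ < y₂ → y₂ < y₃ → y₃ ≤ m₂ →
  EntryOne A (x , y₁) → EntryOne A (x , y₃) → EntryOne A (x , y₂)

ConsecutiveOnesColumns : ℕ → ℕ → Subset → Set
ConsecutiveOnesColumns m₁ m₂ A =
  ∀ y x₁ x₂ x₃ → 1 ≤ y → y ≤ m₂ → 1 ≤ x₁ → x₁ < x₂ → x₂ < x₃ → x₃ ≤ m₁ →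
  EntryOne A (x₁ , y) → EntryOne A (x₃ , y) → EntryOne A (x₂ , y)

-- If q lies strictly between p and r, then q ∈ A
-- or q above some a ∈ A forces r above that element, and q below some a ∈ A
-- forces p below it; so a 0 at q forces a 0 at p or at r.  Rows and columns
-- are the special case of three collinear points.
module Submission where

open import Defs
open import Data.Nat using (ℕ; _≤_; _<_)
open import Data.Nat.Properties using (≤-trans; <-≤-trans; ≤-<-trans; ≤-refl; <⇒≤)
open import Data.Product using (_×_; _,_; proj₁)
open import Data.Sum using (_⊎_; inj₁; inj₂; map)

infix 4 _≤²_

_≤²_ : Point → Point → Set
(x , y) ≤² (x′ , y′) = x ≤ x′ × y ≤ y′

>*-upward : ∀ {p q a} → p >* a → p ≤² q → q >* a
>*-upward {_ , _} {_ , _} {_ , _} ((z≤x , w≤y) , strict) (x≤x′ , y≤y′) =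
  (≤-trans z≤x x≤x′ , ≤-trans w≤y y≤y′) ,
  map (λ z<x → <-≤-trans z<x x≤x′) (λ w<y → <-≤-trans w<y y≤y′) strict

>*-downward : ∀ {a p q} → a >* p → q ≤² p → a >* q
>*-downward {_ , _} {_ , _} {_ , _} ((x≤z , y≤w) , strict) (x′≤x , y′≤y) =
  (≤-trans x′≤x x≤z , ≤-trans y′≤y y≤w) ,
  map (λ x<z → ≤-<-trans x′≤x x<z) (λ y<w → ≤-<-trans y′≤y y<w) strict

entryOne-between : ∀ A {p q r} → q >* p → r >* q →
                   EntryOne A p → EntryOne A r → EntryOne A q
entryOne-between A _ r>*q _ one-r (inj₁ q∈A) =
  one-r (inj₂ (inj₁ (_ , q∈A , r>*q)))
entryOne-between A _ r>*q _ one-r (inj₂ (inj₁ (a , a∈A , q>*a))) =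
  one-r (inj₂ (inj₁ (a , a∈A , >*-upward q>*a (proj₁ r>*q))))
entryOne-between A q>*p _ one-p _ (inj₂ (inj₂ (a , a∈A , a>*q))) =
  one-p (inj₂ (inj₂ (a , a∈A , >*-downward a>*q (proj₁ q>*p))))

>*-along-row : ∀ {x y y′} → y < y′ → (x , y′) >* (x , y)
>*-along-row y<y′ = (≤-refl , <⇒≤ y<y′) , inj₂ y<y′

>*-along-column : ∀ {x x′ y} → x < x′ → (x′ , y) >* (x , y)
>*-along-column x<x′ = (<⇒≤ x<x′ , ≤-refl) , inj₁ x<x′

proposition2 : (m₁ m₂ : ℕ) → 1 ≤ m₁ → 1 ≤ m₂ → (A : Subset) → IsAntichain m₁ m₂ A →
    ConsecutiveOnesRows m₁ m₂ A × ConsecutiveOnesColumns m₁ m₂ A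
proposition2 m₁ m₂ _ _ A _ = rows , columns
  where
  rows : ConsecutiveOnesRows m₁ m₂ A
  rows x y₁ y₂ y₃ _ _ _ y₁<y₂ y₂<y₃ _ =
    entryOne-between A (>*-along-row y₁<y₂) (>*-along-row y₂<y₃)

  columns : ConsecutiveOnesColumns m₁ m₂ A
  columns y x₁ x₂ x₃ _ _ _ x₁<x₂ x₂<x₃ _ =
    entryOne-between A (>*-along-column x₁<x₂) (>*-along-column x₂<x₃)
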